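{- For any connected graph $G=(V,E)$, $$\sum_{\substack{V_1\subseteq V\\ E(G[V\setminus V_1])=\emptyset}} 2^{|\mathrm{cc}(G[V_1])|}\le 3\cdot 2^{|V|-1}.$$
   Context: For a graph $H$, $\mathrm{cc}(H)$ denotes the set of connected components of $H$. For $X\subseteq V$, $G[X]$ is the subgraph induced by $X$ and $E(G[X])$ its edge set; thus the sum ranges over all vertex covers $V_1$ of $G$. -}

module Defs where

open import Data.Nat using (ℕ; zero; suc; _+_; _*_; _^_)
open import Data.Bool using (Bool; true; false; if_then_else_; _∨_)
open import Data.Fin using (Fin)
open import Data.Fin.Subset using (Subset; _∈_)
open import Data.Vec using ([]; _∷_)
open import Data.List using (List; []; _∷_; map; _++_; allFin)
open import Data.Bool.ListAction using (and)
open import Data.Nat.ListAction using (sum)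
open import Data.Product using (Σ; _×_)
open import Relation.Binary.PropositionalEquality using (_≡_)
open import Function.Bundles using (_⇔_)
open import Function.Definitions using (Surjective)

record Graph (n : ℕ) : Set where
  field
    adj   : Fin n → Fin n → Bool
    sym   : ∀ u v → adj u v ≡ adj v u
    irrefl : ∀ v → adj v v ≡ false
open Graph public

data Reach {n : ℕ} (G : Graph n) (X : Subset n) : Fin n → Fin n → Set where
  here : ∀ {v} → v ∈ X → Reach G X v v
  step : ∀ {u w v} → u ∈ X → adj G u w ≡ true → Reach G X w v → Reach G X u v

full : ∀ {n} → Subset n
full {zero}  = []
full {suc n} = true ∷ full

Connected : ∀ {n} → Graph n → Set
Connected {n} G = ∀ (u v : Fin n) → Reach G full u v

Vert : ∀ {n} → Subset n → Set
Vert {n} X = Σ (Fin n) (λ v → v ∈ X)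

-- G[X] has exactly k connected components: there is a surjection from the
-- vertices of G[X] onto Fin k whose fibres are exactly the reachability classes.
IsNumComponents : ∀ {n} → Graph n → Subset n → ℕ → Set
IsNumComponents G X k =
  Σ (Vert X → Fin k) λ f →
    Surjective _≡_ _≡_ f ×
    (∀ (p q : Vert X) → (f p ≡ f q) ⇔ Reach G X (Σ.proj₁ p) (Σ.proj₁ q))

allSubsets : ∀ n → List (Subset n)
allSubsets zero    = [] ∷ []
allSubsets (suc n) = map (true ∷_) (allSubsets n) ++ map (false ∷_) (allSubsets n)

mem : ∀ {n} → Fin n → Subset n → Bool
mem Fin.zero    (b ∷ _)  = b
mem (Fin.suc i) (_ ∷ bs) = mem i bs

-- X is a vertex cover, i.e. G[V \ X] has no edges.
isCover : ∀ {n} → Graph n → Subset n → Bool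
isCover {n} G X =
  and (map (λ u → and (map (λ v → if adj G u v then mem u X ∨ mem v X else true) (allFin n))) (allFin n))

coverSum : ∀ {n} → Graph n → (Subset n → ℕ) → ℕ
coverSum {n} G c = sum (map (λ X → if isCover G X then 2 ^ c X else 0) (allSubsets n))

-- Fix a breadth-first spanning tree rooted at vertex zero. For a vertex cover X, every component
-- of G[X] contains a top vertex: one in X whose tree parent lies outside X (or the root). Hence
-- 2^c(X) ≤ ∏ᵤ w_X(u), where w_X(u) is 2 at tops, 0 at a vertex outside X whose parent is also
-- outside X (impossible for a cover), and 1 otherwise. Summing this product over all X ⊆ V and
-- eliminating the vertices from the leaves of the tree upwards, each non-root vertex contributes
-- w(u ∉ X) + w(u ∈ X) = 2 whatever its parent does, and the root contributes 1 + 2, so the sum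
-- is 3 · 2^(|V|-1).

module Submission where

open import Defs
open import Data.Nat using (ℕ; _*_; _^_; _≤_)
open import Data.Fin.Subset using (Subset)

open import Data.Bool using (Bool; true; false; if_then_else_; _∨_; _∧_; T)
open import Data.Bool.ListAction using (and; any)
open import Data.Bool.Properties using (T-≡; T-∨; T-∧)
open import Data.Empty using (⊥-elim)
open import Data.Fin using (Fin; zero; suc; toℕ; punchIn; punchOut)
import Data.Fin.Properties as Fin
open import Data.Fin.Subset using (_∈_)
open import Data.List using (map; allFin; _++_)
import Data.List.Properties as List
import Data.List.Relation.Unary.All as All
open import Data.List.Relation.Unary.All.Properties using (all⁺)
open import Data.List.Relation.Unary.Any using (satisfied)
open import Data.List.Relation.Unary.Any.Properties using (any⁺; any⁻)
open import Data.List.Membership.Propositional using (lose)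
open import Data.List.Membership.Propositional.Properties using (∈-allFin)
open import Data.Nat using (zero; suc; _+_; _<_; z≤n; s≤s)
open import Data.Nat.DivMod using (_%_; [m+kn]%n≡m%n; m<n⇒m%n≡m)
open import Data.Nat.Induction using (<-wellFounded)
open import Data.Nat.ListAction using (sum)
open import Data.Nat.ListAction.Properties using (sum-++)
open import Data.Nat.Properties
open import Algebra.Properties.CommutativeSemigroup +-commutativeSemigroup
  using () renaming (interchange to +-interchange)
open import Algebra.Properties.CommutativeMonoid.Sum *-1-commutativeMonoid
  using () renaming ( sum to ∏; sum-remove to ∏-remove; sum-cong-≗ to ∏-cong
                    ; sum-replicate-zero to ∏-replicate-1)
open import Algebra.Properties.CommutativeMonoid.Sum +-0-commutativeMonoid
  using () renaming (sum to ∑; sum-remove to ∑-remove)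
open import Data.Product using (Σ; _×_; _,_; proj₁; proj₂; ∃-syntax)
open import Data.Sum using (inj₁; inj₂)
open import Data.Vec using ([]; _∷_; lookup; _[_]≔_)
open import Data.Vec.Functional using (removeAt)
open import Data.Vec.Properties using (lookup∘updateAt; lookup∘updateAt′; []=⇒lookup; lookup⇒[]=)
open import Function using (_∘_)
open import Function.Bundles using (Equivalence)
open import Function.Definitions using (Injective)
open import Induction.WellFounded using (Acc; acc)
open import Relation.Binary.PropositionalEquality
  using (_≡_; _≢_; refl; trans; cong; cong₂; subst; module ≡-Reasoning)
import Relation.Binary.PropositionalEquality as ≡
open import Relation.Nullary using (¬_; yes; no)

subsetSum : ∀ n → (Subset n → ℕ) → ℕ
subsetSum zero    F = F []
subsetSum (suc n) F = subsetSum n (F ∘ (true ∷_)) + subsetSum n (F ∘ (false ∷_))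

sum-map-allSubsets : ∀ n (F : Subset n → ℕ) → sum (map F (allSubsets n)) ≡ subsetSum n F
sum-map-allSubsets zero    F = +-identityʳ (F [])
sum-map-allSubsets (suc n) F = begin
  sum (map F (map (true ∷_) Xs ++ map (false ∷_) Xs))
    ≡⟨ cong sum (List.map-++ F (map (true ∷_) Xs) _) ⟩
  sum (map F (map (true ∷_) Xs) ++ map F (map (false ∷_) Xs))
    ≡⟨ sum-++ (map F (map (true ∷_) Xs)) _ ⟩
  sum (map F (map (true ∷_) Xs)) + sum (map F (map (false ∷_) Xs))
    ≡⟨ cong₂ _+_ (cong sum (List.map-∘ Xs)) (cong sum (List.map-∘ Xs)) ⟨
  sum (map (F ∘ (true ∷_)) Xs) + sum (map (F ∘ (false ∷_)) Xs)
    ≡⟨ cong₂ _+_ (sum-map-allSubsets n _) (sum-map-allSubsets n _) ⟩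
  subsetSum (suc n) F ∎
  where
  open ≡-Reasoning
  Xs = allSubsets n

subsetSum-cong : ∀ n {F G : Subset n → ℕ} → (∀ X → F X ≡ G X) → subsetSum n F ≡ subsetSum n G
subsetSum-cong zero    F≗G = F≗G []
subsetSum-cong (suc n) F≗G =
  cong₂ _+_ (subsetSum-cong n (F≗G ∘ (true ∷_))) (subsetSum-cong n (F≗G ∘ (false ∷_)))

subsetSum-mono : ∀ n {F G : Subset n → ℕ} → (∀ X → F X ≤ G X) → subsetSum n F ≤ subsetSum n G
subsetSum-mono zero    F≤G = F≤G []
subsetSum-mono (suc n) F≤G =
  +-mono-≤ (subsetSum-mono n (F≤G ∘ (true ∷_))) (subsetSum-mono n (F≤G ∘ (false ∷_)))

subsetSum-distrib-+ : ∀ n (F G : Subset n → ℕ) →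
                      subsetSum n (λ X → F X + G X) ≡ subsetSum n F + subsetSum n G
subsetSum-distrib-+ zero    F G = refl
subsetSum-distrib-+ (suc n) F G = begin
  subsetSum n (λ X → F (true ∷ X) + G (true ∷ X)) + subsetSum n (λ X → F (false ∷ X) + G (false ∷ X))
    ≡⟨ cong₂ _+_ (subsetSum-distrib-+ n _ _) (subsetSum-distrib-+ n _ _) ⟩
  (Ft + Gt) + (Ff + Gf)
    ≡⟨ +-interchange Ft Gt Ff Gf ⟩
  (Ft + Ff) + (Gt + Gf) ∎
  where
  open ≡-Reasoning
  Ft = subsetSum n (F ∘ (true ∷_))
  Ff = subsetSum n (F ∘ (false ∷_))
  Gt = subsetSum n (G ∘ (true ∷_))
  Gf = subsetSum n (G ∘ (false ∷_))

subsetSum-*ˡ : ∀ n k (F : Subset n → ℕ) → subsetSum n (λ X → k * F X) ≡ k * subsetSum n F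
subsetSum-*ˡ zero    k F = refl
subsetSum-*ˡ (suc n) k F =
  trans (cong₂ _+_ (subsetSum-*ˡ n k _) (subsetSum-*ˡ n k _))
        (≡.sym (*-distribˡ-+ k (subsetSum n (F ∘ (true ∷_))) _))

subsetSum-const : ∀ n k → subsetSum n (λ _ → k) ≡ k * 2 ^ n
subsetSum-const zero    k = ≡.sym (*-identityʳ k)
subsetSum-const (suc n) k = begin
  subsetSum n (λ _ → k) + subsetSum n (λ _ → k) ≡⟨ cong₂ _+_ (subsetSum-const n k) (subsetSum-const n k) ⟩
  k * 2 ^ n + k * 2 ^ n                         ≡⟨ *-distribˡ-+ k (2 ^ n) (2 ^ n) ⟨
  k * (2 ^ n + 2 ^ n)                           ≡⟨ cong (λ x → k * (2 ^ n + x)) (+-identityʳ (2 ^ n)) ⟨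
  k * 2 ^ suc n                                 ∎
  where open ≡-Reasoning

subsetSum-[]≔ : ∀ n (v : Fin n) (F : Subset n → ℕ) →
                2 * subsetSum n F ≡ subsetSum n (λ X → F (X [ v ]≔ true) + F (X [ v ]≔ false))
subsetSum-[]≔ (suc n) zero F = begin
  Ft + Ff + (Ft + Ff + 0)                                 ≡⟨ cong (Ft + Ff +_) (+-identityʳ (Ft + Ff)) ⟩
  Ft + Ff + (Ft + Ff)                                     ≡⟨ cong₂ _+_ split split ⟩
  subsetSum (suc n) (λ X → F (X [ zero ]≔ true) + F (X [ zero ]≔ false)) ∎
  where
  open ≡-Reasoning
  Ft = subsetSum n (F ∘ (true ∷_))
  Ff = subsetSum n (F ∘ (false ∷_))
  split : Ft + Ff ≡ subsetSum n (λ X → F (true ∷ X) + F (false ∷ X))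
  split = ≡.sym (subsetSum-distrib-+ n (F ∘ (true ∷_)) (F ∘ (false ∷_)))
subsetSum-[]≔ (suc n) (suc v) F =
  trans (*-distribˡ-+ 2 (subsetSum n (F ∘ (true ∷_))) _)
        (cong₂ _+_ (subsetSum-[]≔ n v (F ∘ (true ∷_))) (subsetSum-[]≔ n v (F ∘ (false ∷_))))

∏-extract : ∀ {n} (v : Fin (suc n)) {g h : Fin (suc n) → ℕ} →
            (∀ u → u ≢ v → g u ≡ h u) → h v ≡ 1 → ∏ g ≡ g v * ∏ h
∏-extract v {g} {h} g≗h h[v]≡1 = begin
  ∏ g                    ≡⟨ ∏-remove {i = v} g ⟩
  g v * ∏ (removeAt g v) ≡⟨ cong (g v *_) (∏-cong (λ i → g≗h (punchIn v i) (Fin.punchInᵢ≢i v i))) ⟩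
  g v * ∏ (removeAt h v) ≡⟨ cong (g v *_) (*-identityˡ _) ⟨
  g v * (1 * ∏ (removeAt h v))   ≡⟨ cong (λ x → g v * (x * ∏ (removeAt h v))) h[v]≡1 ⟨
  g v * (h v * ∏ (removeAt h v)) ≡⟨ cong (g v *_) (∏-remove {i = v} h) ⟨
  g v * ∏ h                      ∎
  where open ≡-Reasoning

1≤∏ : ∀ {n} (g : Fin n → ℕ) → (∀ u → 1 ≤ g u) → 1 ≤ ∏ g
1≤∏ {zero}  g 1≤g = ≤-refl
1≤∏ {suc n} g 1≤g = *-mono-≤ (1≤g zero) (1≤∏ (g ∘ suc) (1≤g ∘ suc))

^≤∏ : ∀ {n k} b (g : Fin n → ℕ) → (∀ u → 1 ≤ g u) →
      (h : Fin k → Fin n) → Injective _≡_ _≡_ h → (∀ j → b ≤ g (h j)) → b ^ k ≤ ∏ g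
^≤∏ {k = zero} b g 1≤g h _ _ = 1≤∏ g 1≤g
^≤∏ {zero} {suc k} b g 1≤g h _ _ with () ← h zero
^≤∏ {suc n} {suc k} b g 1≤g h h-inj b≤g∘h = begin
  b * b ^ k
    ≤⟨ *-mono-≤ (b≤g∘h zero) (^≤∏ b (removeAt g v) (1≤g ∘ punchIn v) h′ h′-inj b≤g∘h′) ⟩
  g v * ∏ (removeAt g v)
    ≡⟨ ∏-remove {i = v} g ⟨
  ∏ g ∎
  where
  open ≤-Reasoning
  v = h zero
  v≢h∘suc : ∀ j → v ≢ h (suc j)
  v≢h∘suc j v≡h[j+1] with () ← h-inj v≡h[j+1]
  h′ : Fin k → Fin n
  h′ j = punchOut (v≢h∘suc j)
  h′-inj : Injective _≡_ _≡_ h′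
  h′-inj h′i≡h′j =
    Fin.suc-injective (h-inj (Fin.punchOut-injective (v≢h∘suc _) (v≢h∘suc _) h′i≡h′j))
  b≤g∘h′ : ∀ j → b ≤ removeAt g v (h′ j)
  b≤g∘h′ j = subst (λ u → b ≤ g u) (≡.sym (Fin.punchIn-punchOut (v≢h∘suc j))) (b≤g∘h (suc j))

≤∑ : ∀ {n} (f : Fin (suc n) → ℕ) i → f i ≤ ∑ f
≤∑ f i = subst (f i ≤_) (≡.sym (∑-remove {i = i} f)) (m≤m+n (f i) _)

firstTrue : (ℕ → Bool) → ℕ → ℕ
firstTrue P zero    = zero
firstTrue P (suc K) = if P 0 then 0 else suc (firstTrue (P ∘ suc) K)

firstTrue-true : ∀ (P : ℕ → Bool) K → T (P K) → T (P (firstTrue P K))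
firstTrue-true P zero    PK = PK
firstTrue-true P (suc K) PK with P 0 in P0
... | true  = Equivalence.from T-≡ P0
... | false = firstTrue-true (P ∘ suc) K PK

firstTrue-≤ : ∀ (P : ℕ → Bool) K {j} → T (P j) → firstTrue P K ≤ j
firstTrue-≤ P zero    _ = z≤n
firstTrue-≤ P (suc K) {j} Pj with P 0 in P0 | j
... | true  | _     = z≤n
... | false | zero  = ⊥-elim (subst T P0 Pj)
... | false | suc j = s≤s (firstTrue-≤ (P ∘ suc) K Pj)

-- Rooted at zero: parent i is the parent of the vertex suc i.
record SpanningTree {m} (G : Graph (suc m)) : Set where
  field
    parent       : Fin m → Fin (suc m)
    depth        : Fin (suc m) → ℕ
    depth-root   : depth zero ≡ 0
    depth-parent : ∀ i → depth (parent i) < depth (suc i)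
    parent-adj   : ∀ i → adj G (suc i) (parent i) ≡ true

module _ {m} (G : Graph (suc m)) where

  ball : ℕ → Fin (suc m) → Bool
  ball zero    zero    = true
  ball zero    (suc _) = false
  ball (suc k) v       = ball k v ∨ any (λ w → adj G v w ∧ ball k w) (allFin (suc m))

  ball-step : ∀ {k v w} → adj G v w ≡ true → T (ball k w) → T (ball (suc k) v)
  ball-step {k} {v} {w} v~w w∈ball =
    Equivalence.from (T-∨ {ball k v})
      (inj₂ (any⁺ (λ u → adj G v u ∧ ball k u)
                  (lose (∈-allFin w) (Equivalence.from T-∧ (Equivalence.from T-≡ v~w , w∈ball)))))

  reach⇒ball : ∀ {X v} → Reach G X v zero → ∃[ k ] T (ball k v)
  reach⇒ball (here _)           = 0 , _
  reach⇒ball (step _ v~w w⇝0) with k , w∈ball ← reach⇒ball w⇝0 = suc k , ball-step {k} v~w w∈ball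

  ball-suc : ∀ {k v} → T (ball (suc k) v) → ¬ T (ball k v) → ∃[ w ] adj G v w ≡ true × T (ball k w)
  ball-suc {k} {v} v∈ball v∉ball with Equivalence.to (T-∨ {ball k v}) v∈ball
  ... | inj₁ v∈ball′ = ⊥-elim (v∉ball v∈ball′)
  ... | inj₂ near with w , v~w∧w∈ball ← satisfied (any⁻ _ (allFin (suc m)) near)
                  with v~w , w∈ball ← Equivalence.to T-∧ v~w∧w∈ball =
    w , Equivalence.to T-≡ v~w , w∈ball

  connected⇒spanningTree : Connected G → SpanningTree G
  connected⇒spanningTree conn = record
    { parent       = proj₁ ∘ parent-exists
    ; depth        = depth
    ; depth-root   = n≤0⇒n≡0 (depth-≤ {0} {zero} _)
    ; depth-parent = proj₂ ∘ proj₂ ∘ parent-exists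
    ; parent-adj   = proj₁ ∘ proj₂ ∘ parent-exists
    }
    where
    distanceBound : ∀ v → ∃[ k ] T (ball k v)
    distanceBound v = reach⇒ball (conn v zero)

    depth : Fin (suc m) → ℕ
    depth v = firstTrue (λ k → ball k v) (proj₁ (distanceBound v))

    in-ball : ∀ v → T (ball (depth v) v)
    in-ball v = firstTrue-true (λ k → ball k v) (proj₁ (distanceBound v)) (proj₂ (distanceBound v))

    depth-≤ : ∀ {k v} → T (ball k v) → depth v ≤ k
    depth-≤ {v = v} = firstTrue-≤ (λ k → ball k v) (proj₁ (distanceBound v))

    parent-exists : ∀ i → ∃[ w ] adj G (suc i) w ≡ true × depth w < depth (suc i)
    parent-exists i with depth (suc i) | in-ball (suc i) | (λ {k} → depth-≤ {k} {suc i})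
    ... | zero  | ()     | _
    ... | suc k | i∈ball | depth≤ with w , i~w , w∈ball ← ball-suc {k} i∈ball (1+n≰n ∘ depth≤) =
      w , i~w , s≤s (depth-≤ w∈ball)

treeWeight : ∀ {m} → (Fin m → Fin (suc m)) → (Bool → ℕ) → (Bool → Bool → ℕ) →
             Subset (suc m) → Fin (suc m) → ℕ
treeWeight parent rootWeight edgeWeight X zero    = rootWeight (lookup X zero)
treeWeight parent rootWeight edgeWeight X (suc i) = edgeWeight (lookup X (parent i)) (lookup X (suc i))

module TreeSum {m} (parent : Fin m → Fin (suc m)) (depth : Fin (suc m) → ℕ)
               (depth-root : depth zero ≡ 0) (depth-parent : ∀ i → depth (parent i) < depth (suc i))
               (rootWeight : Bool → ℕ) (edgeWeight : Bool → Bool → ℕ)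
               (edgeWeight-sum : ∀ p → edgeWeight p true + edgeWeight p false ≡ 2) where

  private
    N : ℕ
    N = suc m
    weight : Subset N → Fin N → ℕ
    weight = treeWeight parent rootWeight edgeWeight

  -- An injective rank decreasing along parents: u is recovered as key u % N.
  key : Fin N → ℕ
  key u = toℕ u + depth u * N

  key-injective : Injective _≡_ _≡_ key
  key-injective {u} {v} key[u]≡key[v] = Fin.toℕ-injective (begin
    toℕ u     ≡⟨ m<n⇒m%n≡m (Fin.toℕ<n u) ⟨
    toℕ u % N ≡⟨ [m+kn]%n≡m%n (toℕ u) (depth u) N ⟨
    key u % N ≡⟨ cong (_% N) key[u]≡key[v] ⟩
    key v % N ≡⟨ [m+kn]%n≡m%n (toℕ v) (depth v) N ⟩
    toℕ v % N ≡⟨ m<n⇒m%n≡m (Fin.toℕ<n v) ⟩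
    toℕ v     ∎)
    where open ≡-Reasoning

  key-root : key zero ≡ 0
  key-root = cong (_* N) depth-root

  key-parent : ∀ i → key (parent i) < key (suc i)
  key-parent i = begin-strict
    toℕ (parent i) + depth (parent i) * N <⟨ +-monoˡ-< _ (Fin.toℕ<n (parent i)) ⟩
    suc (depth (parent i)) * N            ≤⟨ *-monoˡ-≤ N (depth-parent i) ⟩
    depth (suc i) * N                     ≤⟨ m≤n+m _ (toℕ (suc i)) ⟩
    key (suc i)                           ∎
    where open ≤-Reasoning

  key-<⇒≢ : ∀ {u v} → key u < key v → u ≢ v
  key-<⇒≢ u<v u≡v = <⇒≢ u<v (cong key u≡v)

  weight-[]≔ : ∀ X v b {u} → key u < key v → weight (X [ v ]≔ b) u ≡ weight X u
  weight-[]≔ X v b {zero}  u<v = cong rootWeight (lookup∘updateAt′ zero v (key-<⇒≢ u<v) X)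
  weight-[]≔ X v b {suc i} u<v =
    cong₂ edgeWeight (lookup∘updateAt′ (parent i) v (key-<⇒≢ (<-trans (key-parent i) u<v)) X)
                     (lookup∘updateAt′ (suc i) v (key-<⇒≢ u<v) X)

  activeWeight : ℕ → Subset N → Fin N → ℕ
  activeWeight t X u with key u <? t
  ... | yes _ = weight X u
  ... | no  _ = 1

  active : ∀ {t X u} → key u < t → activeWeight t X u ≡ weight X u
  active {t} {X} {u} u<t with key u <? t
  ... | yes _   = refl
  ... | no  u≮t = ⊥-elim (u≮t u<t)

  inactive : ∀ {t X u} → ¬ key u < t → activeWeight t X u ≡ 1
  inactive {t} {X} {u} u≮t with key u <? t
  ... | yes u<t = ⊥-elim (u≮t u<t)
  ... | no  _   = refl

  activeWeight-suc : ∀ {t X u} → key u ≢ t → activeWeight (suc t) X u ≡ activeWeight t X u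
  activeWeight-suc {t} {X} {u} u≢t with key u <? t
  ... | yes u<t = active (m<n⇒m<1+n u<t)
  ... | no  u≮t = inactive (λ u<1+t → u≮t (≤∧≢⇒< (≤-pred u<1+t) u≢t))

  activeWeight-[]≔ : ∀ {t} X v b u → t ≤ key v → activeWeight t (X [ v ]≔ b) u ≡ activeWeight t X u
  activeWeight-[]≔ {t} X v b u t≤v with key u <? t
  ... | yes u<t = weight-[]≔ X v b (<-≤-trans u<t t≤v)
  ... | no  _   = refl

  ∏-activeWeight-[]≔ : ∀ {t} i X b → key (suc i) ≡ t →
    ∏ (activeWeight (suc t) (X [ suc i ]≔ b)) ≡ edgeWeight (lookup X (parent i)) b * ∏ (activeWeight t X)
  ∏-activeWeight-[]≔ {t} i X b key[v]≡t = begin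
    ∏ (activeWeight (suc t) (X [ v ]≔ b))
      ≡⟨ ∏-extract v {activeWeight (suc t) (X [ v ]≔ b)} agree-off-v v-inactive ⟩
    activeWeight (suc t) (X [ v ]≔ b) v * ∏ₜ
      ≡⟨ cong (_* ∏ₜ) (active (s≤s (≤-reflexive key[v]≡t))) ⟩
    weight (X [ v ]≔ b) v * ∏ₜ
      ≡⟨ cong (_* ∏ₜ) (cong₂ edgeWeight (lookup∘updateAt′ (parent i) v (key-<⇒≢ (key-parent i)) X)
                                        (lookup∘updateAt v X)) ⟩
    edgeWeight (lookup X (parent i)) b * ∏ₜ ∎
    where
    open ≡-Reasoning
    v = suc i
    ∏ₜ = ∏ (activeWeight t X)
    v-inactive : activeWeight t X v ≡ 1
    v-inactive = inactive (λ v<t → <⇒≢ v<t key[v]≡t)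
    agree-off-v : ∀ u → u ≢ v → activeWeight (suc t) (X [ v ]≔ b) u ≡ activeWeight t X u
    agree-off-v u u≢v =
      trans (activeWeight-suc (λ key[u]≡t → u≢v (key-injective (trans key[u]≡t (≡.sym key[v]≡t)))))
            (activeWeight-[]≔ X v b u (≤-reflexive (≡.sym key[v]≡t)))

  activeSum : ℕ → ℕ
  activeSum t = subsetSum N (∏ ∘ activeWeight t)

  activeSum-1 : activeSum 1 ≡ (rootWeight true + rootWeight false) * 2 ^ m
  activeSum-1 = begin
    subsetSum N (∏ ∘ activeWeight 1)
      ≡⟨ subsetSum-cong N ∏-activeWeight-1 ⟩
    subsetSum m (λ _ → rootWeight true) + subsetSum m (λ _ → rootWeight false)
      ≡⟨ cong₂ _+_ (subsetSum-const m _) (subsetSum-const m _) ⟩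
    rootWeight true * 2 ^ m + rootWeight false * 2 ^ m
      ≡⟨ *-distribʳ-+ (2 ^ m) (rootWeight true) _ ⟨
    (rootWeight true + rootWeight false) * 2 ^ m ∎
    where
    open ≡-Reasoning
    ∏-activeWeight-1 : ∀ X → ∏ (activeWeight 1 X) ≡ rootWeight (lookup X zero)
    ∏-activeWeight-1 X = begin
      ∏ (activeWeight 1 X)
        ≡⟨ ∏-extract zero {activeWeight 1 X} {λ _ → 1} only-root refl ⟩
      activeWeight 1 X zero * ∏ {N} (λ _ → 1)
        ≡⟨ cong₂ _*_ (active (s≤s (≤-reflexive key-root))) (∏-replicate-1 N) ⟩
      rootWeight (lookup X zero) * 1
        ≡⟨ *-identityʳ _ ⟩
      rootWeight (lookup X zero) ∎
      where
      only-root : ∀ u → u ≢ zero → activeWeight 1 X u ≡ 1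
      only-root u u≢0 = inactive (λ u<1 → u≢0 (key-injective (trans (n<1⇒n≡0 u<1) (≡.sym key-root))))

  -- The vertex of key t + 1 has no active child, so summing out its bit only touches its own
  -- factor, whose two values add up to 2.
  activeSum-suc : ∀ t → activeSum (suc (suc t)) ≡ activeSum (suc t)
  activeSum-suc t with Fin.any? (λ v → key v ≟ suc t)
  ... | no ∄v =
    subsetSum-cong N (λ X → ∏-cong {x = activeWeight (2 + t) X}
                                   (λ u → activeWeight-suc (λ key[u]≡1+t → ∄v (u , key[u]≡1+t))))
  ... | yes (zero  , key[0]≡1+t) = ⊥-elim (0≢1+n (trans (≡.sym key-root) key[0]≡1+t))
  ... | yes (suc i , key[v]≡1+t) = *-cancelˡ-≡ _ _ 2 (begin
    2 * activeSum (2 + t)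
      ≡⟨ subsetSum-[]≔ N (suc i) (∏ ∘ activeWeight (2 + t)) ⟩
    subsetSum N (λ X → ∏ (activeWeight (2 + t) (X [ suc i ]≔ true))
                     + ∏ (activeWeight (2 + t) (X [ suc i ]≔ false)))
      ≡⟨ subsetSum-cong N both-values ⟩
    subsetSum N (λ X → 2 * ∏ (activeWeight (1 + t) X))
      ≡⟨ subsetSum-*ˡ N 2 (∏ ∘ activeWeight (1 + t)) ⟩
    2 * activeSum (1 + t) ∎)
    where
    open ≡-Reasoning
    both-values : ∀ X → ∏ (activeWeight (2 + t) (X [ suc i ]≔ true))
                        + ∏ (activeWeight (2 + t) (X [ suc i ]≔ false))
                        ≡ 2 * ∏ (activeWeight (1 + t) X)
    both-values X = begin
      _                                                ≡⟨ cong₂ _+_ (∏-activeWeight-[]≔ i X true key[v]≡1+t)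
                                                                    (∏-activeWeight-[]≔ i X false key[v]≡1+t) ⟩
      edgeWeight p true * ∏ₜ + edgeWeight p false * ∏ₜ ≡⟨ *-distribʳ-+ ∏ₜ (edgeWeight p true) _ ⟨
      (edgeWeight p true + edgeWeight p false) * ∏ₜ    ≡⟨ cong (_* ∏ₜ) (edgeWeight-sum p) ⟩
      2 * ∏ₜ                                           ∎
      where
      p = lookup X (parent i)
      ∏ₜ = ∏ (activeWeight (1 + t) X)

  activeSum-value : ∀ t → activeSum (suc t) ≡ (rootWeight true + rootWeight false) * 2 ^ m
  activeSum-value zero    = activeSum-1
  activeSum-value (suc t) = trans (activeSum-suc t) (activeSum-value t)

  subsetSum-∏-treeWeight : subsetSum N (∏ ∘ weight) ≡ (rootWeight true + rootWeight false) * 2 ^ m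
  subsetSum-∏-treeWeight =
    trans (subsetSum-cong N (λ X → ∏-cong {x = weight X} (λ u → ≡.sym (active (s≤s (≤∑ key u))))))
          (activeSum-value (∑ key))

mem≡lookup : ∀ {n} (u : Fin n) X → mem u X ≡ lookup X u
mem≡lookup zero    (_ ∷ _) = refl
mem≡lookup (suc u) (_ ∷ X) = mem≡lookup u X

isCover⇒covered : ∀ {n} (G : Graph n) X {u w} → isCover G X ≡ true → adj G u w ≡ true →
                  lookup X u ∨ lookup X w ≡ true
isCover⇒covered {n} G X {u} {w} cover u~w =
  Equivalence.to T-≡ (subst T edge-test (All.lookup tests-at-u (∈-allFin w)))
  where
  test : Fin n → Fin n → Bool
  test u w = if adj G u w then mem u X ∨ mem w X else true
  all-tests : All.All (λ u → T (and (map (test u) (allFin n)))) (allFin n)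
  all-tests = all⁺ (λ u → and (map (test u) (allFin n))) (allFin n) (Equivalence.from T-≡ cover)
  tests-at-u : All.All (T ∘ test u) (allFin n)
  tests-at-u = all⁺ (test u) (allFin n) (All.lookup all-tests (∈-allFin u))
  edge-test : test u w ≡ lookup X u ∨ lookup X w
  edge-test = trans (cong (if_then mem u X ∨ mem w X else true) u~w)
                    (cong₂ _∨_ (mem≡lookup u X) (mem≡lookup w X))

components-empty : ∀ (G : Graph 0) {k} → IsNumComponents G [] k → k ≡ 0
components-empty G {zero}  _                  = refl
components-empty G {suc k} (_ , f-surjective , _) with (() , _) , _ ← f-surjective zero

coverRootWeight : Bool → ℕ
coverRootWeight b = if b then 2 else 1

coverEdgeWeight : Bool → Bool → ℕ
coverEdgeWeight p b = if p then 1 else if b then 2 else 0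

coverEdgeWeight-sum : ∀ p → coverEdgeWeight p true + coverEdgeWeight p false ≡ 2
coverEdgeWeight-sum true  = refl
coverEdgeWeight-sum false = refl

module Covers {m} (G : Graph (suc m)) (tree : SpanningTree G) where

  open SpanningTree tree

  coverWeight : Subset (suc m) → Fin (suc m) → ℕ
  coverWeight = treeWeight parent coverRootWeight coverEdgeWeight

  coverWeight-positive : ∀ {X} → isCover G X ≡ true → ∀ u → 1 ≤ coverWeight X u
  coverWeight-positive {X} cover zero with lookup X zero
  ... | true  = s≤s z≤n
  ... | false = s≤s z≤n
  coverWeight-positive {X} cover (suc i)
    with lookup X (parent i) | lookup X (suc i) | isCover⇒covered G X cover (parent-adj i)
  ... | true  | _     | _  = s≤s z≤n
  ... | false | true  | _  = s≤s z≤n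
  ... | false | false | ()

  climb : ∀ {X} q → q ∈ X → Acc _<_ (depth q) → ∃[ u ] Reach G X q u × u ∈ X × coverWeight X u ≡ 2
  climb zero q∈X _ = zero , here q∈X , q∈X , cong coverRootWeight ([]=⇒lookup q∈X)
  climb {X} (suc i) q∈X (acc rs) with lookup X (parent i) in parent∈?
  ... | false = suc i , here q∈X , q∈X , cong₂ coverEdgeWeight parent∈? ([]=⇒lookup q∈X)
  ... | true with u , parent⇝u , u∈X , top ← climb (parent i) (lookup⇒[]= (parent i) X parent∈?)
                                                  (rs (depth-parent i)) =
    u , step q∈X (parent-adj i) parent⇝u , u∈X , top

  2^components≤∏coverWeight : ∀ {X k} → isCover G X ≡ true → IsNumComponents G X k →
                              2 ^ k ≤ ∏ (coverWeight X)
  2^components≤∏coverWeight {X} {k} cover (f , f-surjective , f≡⇔reach) =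
    ^≤∏ 2 (coverWeight X) (coverWeight-positive cover) top top-injective (≤-reflexive ∘ ≡.sym ∘ top-weight)
    where
    representative : ∀ j → ∃[ u ] Σ (u ∈ X) λ u∈X → coverWeight X u ≡ 2 × f (u , u∈X) ≡ j
    representative j with (q , q∈X) , f[q]≡j ← f-surjective j
                     with u , q⇝u , u∈X , top ← climb q q∈X (<-wellFounded (depth q)) =
      u , u∈X , top , trans (≡.sym (Equivalence.from (f≡⇔reach (q , q∈X) (u , u∈X)) q⇝u)) (f[q]≡j refl)
    top : Fin k → Fin (suc m)
    top = proj₁ ∘ representative
    top∈X : ∀ j → top j ∈ X
    top∈X = proj₁ ∘ proj₂ ∘ representative
    top-weight : ∀ j → coverWeight X (top j) ≡ 2
    top-weight = proj₁ ∘ proj₂ ∘ proj₂ ∘ representative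
    f[top]≡ : ∀ j → f (top j , top∈X j) ≡ j
    f[top]≡ = proj₂ ∘ proj₂ ∘ proj₂ ∘ representative
    top-injective : Injective _≡_ _≡_ top
    top-injective {j} {j′} top≡ = begin
      j                     ≡⟨ f[top]≡ j ⟨
      f (top j , top∈X j)   ≡⟨ Equivalence.from (f≡⇔reach _ _) (subst (Reach G X (top j)) top≡ (here (top∈X j))) ⟩
      f (top j′ , top∈X j′) ≡⟨ f[top]≡ j′ ⟩
      j′                    ∎
      where open ≡-Reasoning

  coverTerm≤∏coverWeight : (c : Subset (suc m) → ℕ) → (∀ X → IsNumComponents G X (c X)) →
                           ∀ X → (if isCover G X then 2 ^ c X else 0) ≤ ∏ (coverWeight X)
  coverTerm≤∏coverWeight c components X with isCover G X in cover
  ... | false = z≤n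
  ... | true  = 2^components≤∏coverWeight cover (components X)

lemma3 : ∀ (n : ℕ) (G : Graph n) → Connected G →
    (c : Subset n → ℕ) → (∀ X → IsNumComponents G X (c X)) →
    2 * coverSum G c ≤ 3 * 2 ^ n
lemma3 zero G _ c components rewrite components-empty G (components []) = s≤s (s≤s z≤n)
lemma3 (suc m) G connected c components = begin
  2 * coverSum G c
    ≡⟨ cong (2 *_) (sum-map-allSubsets (suc m) coverTerm) ⟩
  2 * subsetSum (suc m) coverTerm
    ≤⟨ *-monoʳ-≤ 2 (subsetSum-mono (suc m) (coverTerm≤∏coverWeight c components)) ⟩
  2 * subsetSum (suc m) (∏ ∘ coverWeight)
    ≡⟨ cong (2 *_) (TreeSum.subsetSum-∏-treeWeight parent depth depth-root depth-parent
                      coverRootWeight coverEdgeWeight coverEdgeWeight-sum) ⟩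
  2 * (3 * 2 ^ m)
    ≡⟨ trans (≡.sym (*-assoc 2 3 (2 ^ m))) (*-assoc 3 2 (2 ^ m)) ⟩
  3 * 2 ^ suc m ∎
  where
  open ≤-Reasoning
  tree : SpanningTree G
  tree = connected⇒spanningTree G connected
  open SpanningTree tree
  open Covers G tree
  coverTerm : Subset (suc m) → ℕ
  coverTerm X = if isCover G X then 2 ^ c X else 0
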